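{- Let $G$ be a finite, connected, undirected multigraph without loops with $n$ vertices, reduced Laplacian $\tilde L$, and $m=|\mathrm{Jac}(G)|$. Every reduced monodromy weight $\tilde w\in\mathbb{Z}^{n-1}$ satisfies $\tilde L\tilde w=m\tilde D$ for some $D\in\mathrm{Div}^0(G)$; and for every $D\in\mathrm{Div}^0(G)$ the unique rational solution $\tilde w=m\tilde L^{ -1}\tilde D$ of $\tilde L\tilde w=m\tilde D$ is an integer vector which is a reduced monodromy weight.
   Context: Vertices are indexed $v_1,\dots,v_n$. A divisor is a vector in $\mathbb{Z}^n$; $\mathrm{Div}^0(G)$ is the group of divisors with entry sum $0$; for $D\in\mathrm{Div}^0(G)$, $\tilde D\in\mathbb{Z}^{n-1}$ is $D$ with its $n$-th entry deleted. The Laplacian is $L=\Delta-A$ ($\Delta$ diagonal of valencies, $A_{ij}$ the number of edges between $v_i,v_j$); $\tilde L$ is $L$ with the $n$-th row and column deleted, which is invertible over $\mathbb{Q}$ with $\det\tilde L=m$. $\mathrm{Jac}(G)=\mathrm{Div}^0(G)/\{L\sigma:\sigma\in\mathbb{Z}^n\}$. A monodromy weight is $w\in\mathbb{Z}^n$ with $w\cdot D\equiv0\pmod m$ for all $D=L\sigma$, $\sigma\in\mathbb{Z}^n$. A reduced monodromy weight is a vector $\tilde w\in\mathbb{Z}^{n-1}$ consisting of the first $n-1$ entries of $w-w_n\mathbf 1$ for some monodromy weight $w$; equivalently, $\tilde w\in\mathbb{Z}^{n-1}$ with $\tilde L\tilde w\equiv 0\pmod m$. -}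

module Defs where

open import Data.Nat as ℕ using (ℕ; zero; suc)
open import Data.Fin using (Fin; zero; suc; inject₁; fromℕ; _≟_; punchIn; toℕ)
open import Data.Integer as ℤ using (ℤ; +_; _+_; _-_; _*_; -_; 0ℤ; 1ℤ)
open import Data.Integer.Divisibility using (_∣_)
open import Data.Product using (Σ; _×_; ∃)
open import Relation.Nullary using (yes; no)
open import Relation.Binary.PropositionalEquality using (_≡_)

sumℤ : ∀ {n} → (Fin n → ℤ) → ℤ
sumℤ {zero} f = 0ℤ
sumℤ {suc n} f = f zero + sumℤ (λ i → f (suc i))

dot : ∀ {n} → (Fin n → ℤ) → (Fin n → ℤ) → ℤ
dot u v = sumℤ (λ i → u i * v i)

_·ᵥ_ : ∀ {n} → (Fin n → Fin n → ℤ) → (Fin n → ℤ) → (Fin n → ℤ)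
(M ·ᵥ v) i = dot (M i) v

det : ∀ {n} → (Fin n → Fin n → ℤ) → ℤ
det {zero} M = 1ℤ
det {suc n} M = sumℤ (λ j → sgn (toℕ j) * (M zero j * det (minor j)))
  where
  minor : Fin (suc n) → Fin n → Fin n → ℤ
  minor j r c = M (suc r) (punchIn j c)
  sgn : ℕ → ℤ
  sgn zero = 1ℤ
  sgn (suc k) = - sgn k

-- Finite loopless multigraphs on vertices Fin n, by adjacency matrix:
-- A i j = number of edges between v_i and v_j.

record Multigraph (n : ℕ) : Set where
  field
    adj       : Fin n → Fin n → ℕ
    symmetric : ∀ i j → adj i j ≡ adj j i
    loopless  : ∀ i → adj i i ≡ 0

open Multigraph public

data Reach {n} (G : Multigraph n) : Fin n → Fin n → Set where
  here : ∀ {i} → Reach G i i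
  step : ∀ {i j k} → 1 ℕ.≤ adj G i j → Reach G j k → Reach G i k

Connected : ∀ {n} → Multigraph n → Set
Connected G = ∀ i j → Reach G i j

valency : ∀ {n} → Multigraph n → Fin n → ℤ
valency G i = sumℤ (λ j → + adj G i j)

laplacian : ∀ {n} → Multigraph n → Fin n → Fin n → ℤ
laplacian G i j with i ≟ j
... | yes _ = valency G i - + adj G i j
... | no  _ = - (+ adj G i j)

reducedLaplacian : ∀ {k} → Multigraph (suc k) → Fin k → Fin k → ℤ
reducedLaplacian G i j = laplacian G (inject₁ i) (inject₁ j)

-- m = |Jac(G)| = det L̃ (as recorded in the context).
jacOrder : ∀ {k} → Multigraph (suc k) → ℤ
jacOrder G = det (reducedLaplacian G)

IsDiv0 : ∀ {n} → (Fin n → ℤ) → Set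
IsDiv0 D = sumℤ D ≡ 0ℤ

reduce : ∀ {k} → (Fin (suc k) → ℤ) → (Fin k → ℤ)
reduce D i = D (inject₁ i)

IsMonodromyWeight : ∀ {k} → Multigraph (suc k) → (Fin (suc k) → ℤ) → Set
IsMonodromyWeight G w =
  ∀ (σ : Fin (suc _) → ℤ) → jacOrder G ∣ dot w (laplacian G ·ᵥ σ)

IsReducedMonodromyWeight : ∀ {k} → Multigraph (suc k) → (Fin k → ℤ) → Set
IsReducedMonodromyWeight {k} G w̃ =
  Σ (Fin (suc k) → ℤ) λ w →
    IsMonodromyWeight G w × (∀ i → w̃ i ≡ w (inject₁ i) - w (fromℕ k))

module Submission where

-- Since L is symmetric with zero row sums, testing a monodromy weight w against the
-- basis vectors shows that m divides every entry of L w, and L̃ maps the first n-1 entries of w - wₙ1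
-- to the first n-1 entries of L w; dividing by m and completing to degree zero gives D.  Conversely
-- w̃ = adj(L̃) D̃ solves L̃ w̃ = m D̃ over ℤ; extending w̃ by 0 gives w with L w = m D (the last entries
-- agree since both sides have total sum 0), hence w · L σ = m (D · σ).  The adjugate identity
-- L̃ adj(L̃) = det L̃ · I comes from the Laplace expansion defining det: expanding along two rows shows
-- that swapping them negates the determinant, so a repeated row gives 0 and moving row j to the top
-- multiplies the determinant by (-1)^j.

open import Defs
open import Data.Nat using (ℕ; zero; suc)
open import Data.Fin using (Fin; zero; suc; toℕ; punchIn; punchOut; inject₁; fromℕ; _≟_)
open import Data.Fin.Properties using (punchInᵢ≢i; punchOut-punchIn; punchOut-cong; punchIn-punchOut)
open import Data.Integer using (ℤ; _+_; _-_; _*_; -_; _^_; 0ℤ; 1ℤ; -1ℤ; +0; +[1+_]; -[1+_]; sign; ∣_∣)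
import Data.Integer as Int
import Data.Integer.Properties as ℤ
open import Data.Integer.Tactic.RingSolver using (solve-∀)
open import Data.Integer.Divisibility using (_∣_)
import Data.Integer.Divisibility.Signed as SD
open import Data.Vec.Functional using (_∷_; tail; removeAt; insertAt; transpose)
open import Data.Vec.Functional.Properties using (insertAt-punchIn; insertAt-lookup)
open import Data.Product using (Σ; _×_; _,_)
open import Algebra.Properties.Semiring.Sum ℤ.+-*-semiring
  using (sum; sum-cong-≗; ∑-distrib-+; ∑-comm; *-distribˡ-sum; sum-remove; sum-init-last; sum-replicate-zero)
open import Algebra.Properties.AbelianGroup ℤ.+-0-abelianGroup using (∙-cancelˡ)
open import Function using (_∘_)
open import Relation.Nullary using (yes; no; contradiction)
open import Relation.Binary.PropositionalEquality
  using (_≡_; _≗_; _≢_; refl; sym; trans; cong; cong₂; subst; module ≡-Reasoning)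
open ≡-Reasoning

Matrix : ℕ → Set
Matrix n = Fin n → Fin n → ℤ

sumℤ≡sum : ∀ {n} (f : Fin n → ℤ) → sumℤ f ≡ sum f
sumℤ≡sum {zero}  f = refl
sumℤ≡sum {suc n} f = cong (f zero +_) (sumℤ≡sum (f ∘ suc))

sumℤ-cong : ∀ {n} {f g : Fin n → ℤ} → f ≗ g → sumℤ f ≡ sumℤ g
sumℤ-cong {f = f} {g} f≗g = begin
  sumℤ f ≡⟨ sumℤ≡sum f ⟩
  sum f  ≡⟨ sum-cong-≗ f≗g ⟩
  sum g  ≡⟨ sumℤ≡sum g ⟨
  sumℤ g ∎

sumℤ-zero : ∀ {n} {f : Fin n → ℤ} → (∀ i → f i ≡ 0ℤ) → sumℤ f ≡ 0ℤ
sumℤ-zero {n} f≗0 = trans (sumℤ-cong f≗0) (trans (sumℤ≡sum {n} (λ _ → 0ℤ)) (sum-replicate-zero n))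

sumℤ-distrib-+ : ∀ {n} (f g : Fin n → ℤ) → sumℤ (λ i → f i + g i) ≡ sumℤ f + sumℤ g
sumℤ-distrib-+ f g = begin
  sumℤ (λ i → f i + g i) ≡⟨ sumℤ≡sum (λ i → f i + g i) ⟩
  sum (λ i → f i + g i)  ≡⟨ ∑-distrib-+ f g ⟩
  sum f + sum g          ≡⟨ cong₂ _+_ (sumℤ≡sum f) (sumℤ≡sum g) ⟨
  sumℤ f + sumℤ g        ∎

sumℤ-*ˡ : ∀ {n} c (f : Fin n → ℤ) → sumℤ (λ i → c * f i) ≡ c * sumℤ f
sumℤ-*ˡ c f = begin
  sumℤ (λ i → c * f i) ≡⟨ sumℤ≡sum (λ i → c * f i) ⟩
  sum (λ i → c * f i)  ≡⟨ *-distribˡ-sum c f ⟨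
  c * sum f            ≡⟨ cong (c *_) (sumℤ≡sum f) ⟨
  c * sumℤ f           ∎

sumℤ-comm : ∀ {m n} (f : Fin m → Fin n → ℤ) →
            sumℤ (λ i → sumℤ (f i)) ≡ sumℤ (λ j → sumℤ (λ i → f i j))
sumℤ-comm f = begin
  sumℤ (λ i → sumℤ (f i))         ≡⟨ sumℤ≡sum (λ i → sumℤ (f i)) ⟩
  sum (λ i → sumℤ (f i))          ≡⟨ sum-cong-≗ (sumℤ≡sum ∘ f) ⟩
  sum (λ i → sum (f i))           ≡⟨ ∑-comm f ⟩
  sum (λ j → sum (λ i → f i j))   ≡⟨ sum-cong-≗ (λ j → sumℤ≡sum (λ i → f i j)) ⟨
  sum (λ j → sumℤ (λ i → f i j))  ≡⟨ sumℤ≡sum (λ j → sumℤ (λ i → f i j)) ⟨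
  sumℤ (λ j → sumℤ (λ i → f i j)) ∎

sumℤ-remove : ∀ {n} (j : Fin (suc n)) (f : Fin (suc n) → ℤ) → sumℤ f ≡ f j + sumℤ (f ∘ punchIn j)
sumℤ-remove j f = begin
  sumℤ f                   ≡⟨ sumℤ≡sum f ⟩
  sum f                    ≡⟨ sum-remove f ⟩
  f j + sum (removeAt f j) ≡⟨ cong (f j +_) (sumℤ≡sum (f ∘ punchIn j)) ⟨
  f j + sumℤ (f ∘ punchIn j) ∎

sumℤ-delta : ∀ {n} (j : Fin n) {f : Fin n → ℤ} → (∀ l → l ≢ j → f l ≡ 0ℤ) → sumℤ f ≡ f j
sumℤ-delta {suc n} j {f} off = begin
  sumℤ f                     ≡⟨ sumℤ-remove j f ⟩
  f j + sumℤ (f ∘ punchIn j) ≡⟨ cong (f j +_) (sumℤ-zero (λ c → off (punchIn j c) (punchInᵢ≢i j c))) ⟩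
  f j + 0ℤ                   ≡⟨ ℤ.+-identityʳ (f j) ⟩
  f j                        ∎

sumℤ-neg : ∀ {n} (f : Fin n → ℤ) → sumℤ (λ i → - f i) ≡ - sumℤ f
sumℤ-neg f = begin
  sumℤ (λ i → - f i)        ≡⟨ sumℤ-cong (λ i → sym (ℤ.-1*i≡-i (f i))) ⟩
  sumℤ (λ i → -1ℤ * f i)    ≡⟨ sumℤ-*ˡ -1ℤ f ⟩
  -1ℤ * sumℤ f              ≡⟨ ℤ.-1*i≡-i (sumℤ f) ⟩
  - sumℤ f                  ∎

sumℤ-init-last : ∀ {k} (f : Fin (suc k) → ℤ) → sumℤ f ≡ sumℤ (reduce f) + f (fromℕ k)
sumℤ-init-last f = begin
  sumℤ f                           ≡⟨ sumℤ≡sum f ⟩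
  sum f                            ≡⟨ sum-init-last f ⟩
  sum (reduce f) + f (fromℕ _)     ≡⟨ cong (_+ f (fromℕ _)) (sumℤ≡sum (reduce f)) ⟨
  sumℤ (reduce f) + f (fromℕ _)    ∎

minor : ∀ {n} → Matrix (suc n) → Fin (suc n) → Matrix n
minor M j r c = M (suc r) (punchIn j c)

-- Defs.det multiplies by a sign function local to its where-block.  Unification recovers it,
-- once toℕ i and the arithmetic of ℤ's _*_ are abstracted so that the constraint is a pattern.
module _ {n : ℕ} (M : Matrix (suc n)) where
  private
    mutual
      laterTerms : Fin n → ℤ
      laterTerms = _

      det-unfold : det M ≡ 1ℤ * (M zero zero * det (minor M zero)) + sumℤ laterTerms
      det-unfold = refl

      localSign : ℕ → ℤ
      localSign = _

      laterTerms-sign : ∀ i → laterTerms i ≡ (- localSign (toℕ i)) * (M zero (suc i) * det (minor M (suc i)))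
      laterTerms-sign i with toℕ i | M zero (suc i) * det (minor M (suc i)) | sign | ∣_∣
      ... | _ | _ | _ | _ = refl

    -localSign≡-1^suc : ∀ k → - localSign k ≡ -1ℤ ^ suc k
    -localSign≡-1^suc zero    = refl
    -localSign≡-1^suc (suc k) = trans (cong -_ (-localSign≡-1^suc k)) (sym (ℤ.-1*i≡-i (-1ℤ ^ suc k)))

  det-expand : det M ≡ sumℤ (λ j → -1ℤ ^ toℕ j * (M zero j * det (minor M j)))
  det-expand = trans det-unfold (cong (1ℤ * (M zero zero * det (minor M zero)) +_) (sumℤ-cong (λ i →
    trans (laterTerms-sign i) (cong (_* (M zero (suc i) * det (minor M (suc i)))) (-localSign≡-1^suc (toℕ i))))))

det-cong : ∀ {n} {M N : Matrix n} → (∀ i j → M i j ≡ N i j) → det M ≡ det N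
det-cong {zero}          _   = refl
det-cong {suc n} {M} {N} M≈N = begin
  det M                                                 ≡⟨ det-expand M ⟩
  sumℤ (λ j → -1ℤ ^ toℕ j * (M zero j * det (minor M j))) ≡⟨ sumℤ-cong (λ j → cong₂ (λ x d → -1ℤ ^ toℕ j * (x * d))
                                                             (M≈N zero j) (det-cong (λ r c → M≈N (suc r) (punchIn j c)))) ⟩
  sumℤ (λ j → -1ℤ ^ toℕ j * (N zero j * det (minor N j))) ≡⟨ det-expand N ⟨
  det N                                                 ∎

dot-comm : ∀ {n} (a b : Fin n → ℤ) → dot a b ≡ dot b a
dot-comm a b = sumℤ-cong (λ i → ℤ.*-comm (a i) (b i))

dot-mulᵥ-transpose : ∀ {n} (M : Matrix n) (a b : Fin n → ℤ) → dot a (M ·ᵥ b) ≡ dot (transpose M ·ᵥ a) b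
dot-mulᵥ-transpose M a b = begin
  sumℤ (λ i → a i * sumℤ (λ j → M i j * b j))   ≡⟨ sumℤ-cong (λ i → sumℤ-*ˡ (a i) (λ j → M i j * b j)) ⟨
  sumℤ (λ i → sumℤ (λ j → a i * (M i j * b j))) ≡⟨ sumℤ-comm (λ i j → a i * (M i j * b j)) ⟩
  sumℤ (λ j → sumℤ (λ i → a i * (M i j * b j))) ≡⟨ sumℤ-cong (λ j → sumℤ-cong (λ i → rearrange (a i) (M i j) (b j))) ⟩
  sumℤ (λ j → sumℤ (λ i → b j * (M i j * a i))) ≡⟨ sumℤ-cong (λ j → sumℤ-*ˡ (b j) (λ i → M i j * a i)) ⟩
  sumℤ (λ j → b j * sumℤ (λ i → M i j * a i))   ≡⟨ dot-comm b (transpose M ·ᵥ a) ⟩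
  dot (transpose M ·ᵥ a) b                      ∎
  where
  rearrange : ∀ x m y → x * (m * y) ≡ y * (m * x)
  rearrange = solve-∀

dot-mulᵥ-antisym : ∀ {n} (V : Matrix n) → (∀ j l → V j l ≡ - V l j) →
                   ∀ a b → dot a (V ·ᵥ b) ≡ - dot b (V ·ᵥ a)
dot-mulᵥ-antisym V antisym a b = begin
  dot a (V ·ᵥ b)                                ≡⟨ dot-mulᵥ-transpose V a b ⟩
  sumℤ (λ l → sumℤ (λ j → V j l * a j) * b l)   ≡⟨ sumℤ-cong (λ l → cong (_* b l) (transpose-neg l)) ⟩
  sumℤ (λ l → - (V ·ᵥ a) l * b l)               ≡⟨ sumℤ-cong (λ l → neg-swap ((V ·ᵥ a) l) (b l)) ⟩
  sumℤ (λ l → - (b l * (V ·ᵥ a) l))             ≡⟨ sumℤ-neg (λ l → b l * (V ·ᵥ a) l) ⟩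
  - dot b (V ·ᵥ a)                              ∎
  where
  neg-swap : ∀ x y → - x * y ≡ - (y * x)
  neg-swap = solve-∀
  transpose-neg : ∀ l → sumℤ (λ j → V j l * a j) ≡ - (V ·ᵥ a) l
  transpose-neg l = begin
    sumℤ (λ j → V j l * a j)     ≡⟨ sumℤ-cong (λ j → cong (_* a j) (antisym j l)) ⟩
    sumℤ (λ j → - V l j * a j)   ≡⟨ sumℤ-cong (λ j → sym (ℤ.neg-distribˡ-* (V l j) (a j))) ⟩
    sumℤ (λ j → - (V l j * a j)) ≡⟨ sumℤ-neg (λ j → V l j * a j) ⟩
    - (V ·ᵥ a) l                 ∎

det-∘-tail : ∀ {n} (π : Fin n → Fin n) (ε : ℤ) → (∀ (N : Matrix n) → det (N ∘ π) ≡ ε * det N) →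
             ∀ (a : Fin (suc n) → ℤ) (R : Fin n → Fin (suc n) → ℤ) → det (a ∷ R ∘ π) ≡ ε * det (a ∷ R)
det-∘-tail π ε det-π a R = begin
  det (a ∷ R ∘ π)                                                     ≡⟨ det-expand (a ∷ R ∘ π) ⟩
  sumℤ (λ j → -1ℤ ^ toℕ j * (a j * det (minor (a ∷ R) j ∘ π)))         ≡⟨ sumℤ-cong (λ j →
                                                                         cong (λ d → -1ℤ ^ toℕ j * (a j * d)) (det-π (minor (a ∷ R) j))) ⟩
  sumℤ (λ j → -1ℤ ^ toℕ j * (a j * (ε * det (minor (a ∷ R) j))))       ≡⟨ sumℤ-cong (λ j → pull (-1ℤ ^ toℕ j) (a j) ε (det (minor (a ∷ R) j))) ⟩
  sumℤ (λ j → ε * (-1ℤ ^ toℕ j * (a j * det (minor (a ∷ R) j))))       ≡⟨ sumℤ-*ˡ ε (λ j → -1ℤ ^ toℕ j * (a j * det (minor (a ∷ R) j))) ⟩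
  ε * sumℤ (λ j → -1ℤ ^ toℕ j * (a j * det (minor (a ∷ R) j)))         ≡⟨ cong (ε *_) (det-expand (a ∷ R)) ⟨
  ε * det (a ∷ R)                                                     ∎
  where
  pull : ∀ s x e d → s * (x * (e * d)) ≡ e * (s * (x * d))
  pull = solve-∀

punchIn-punchOut-comm : ∀ {n} {i j : Fin (suc (suc n))} (i≢j : i ≢ j) (j≢i : j ≢ i) →
                        punchIn i ∘ punchIn (punchOut i≢j) ≗ punchIn j ∘ punchIn (punchOut j≢i)
punchIn-punchOut-comm {i = zero}  {zero}  i≢j _ _ = contradiction refl i≢j
punchIn-punchOut-comm {i = zero}  {suc j} _   _ _ = refl
punchIn-punchOut-comm {i = suc i} {zero}  _   _ _ = refl
punchIn-punchOut-comm {i = suc i} {suc j} _   _ zero = refl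
punchIn-punchOut-comm {i = suc i} {suc j} i≢j j≢i (suc x) =
  cong suc (punchIn-punchOut-comm (i≢j ∘ cong suc) (j≢i ∘ cong suc) x)

-1^-punchOut-antisym : ∀ {n} {i j : Fin (suc (suc n))} (i≢j : i ≢ j) (j≢i : j ≢ i) →
  -1ℤ ^ toℕ i * -1ℤ ^ toℕ (punchOut i≢j) ≡ - (-1ℤ ^ toℕ j * -1ℤ ^ toℕ (punchOut j≢i))
-1^-punchOut-antisym {i = zero}  {zero}  i≢j _ = contradiction refl i≢j
-1^-punchOut-antisym {i = zero}  {suc j} _   _ = first-zero (-1ℤ ^ toℕ j)
  where
  first-zero : ∀ s → 1ℤ * s ≡ - ((-1ℤ * s) * 1ℤ)
  first-zero = solve-∀
-1^-punchOut-antisym {i = suc i} {zero}  _   _ = second-zero (-1ℤ ^ toℕ i)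
  where
  second-zero : ∀ s → (-1ℤ * s) * 1ℤ ≡ - (1ℤ * s)
  second-zero = solve-∀
-1^-punchOut-antisym {zero}  {suc zero} {suc zero} i≢j _ = contradiction refl i≢j
-1^-punchOut-antisym {suc n} {suc i}    {suc j}    i≢j j≢i =
  trans (both-suc (-1ℤ ^ toℕ i) (-1ℤ ^ toℕ (punchOut (i≢j ∘ cong suc))))
        (trans (-1^-punchOut-antisym (i≢j ∘ cong suc) (j≢i ∘ cong suc))
               (cong -_ (sym (both-suc (-1ℤ ^ toℕ j) (-1ℤ ^ toℕ (punchOut (j≢i ∘ cong suc)))))))
  where
  both-suc : ∀ s t → (-1ℤ * s) * (-1ℤ * t) ≡ s * t
  both-suc = solve-∀

module _ {n : ℕ} (R : Fin n → Fin (suc (suc n)) → ℤ) where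

  -- pairCofactor j l is the coefficient of a j * b l in det (a ∷ b ∷ R).
  pairCofactor : Matrix (suc (suc n))
  pairCofactor j l with j ≟ l
  ... | yes _  = 0ℤ
  ... | no j≢l = -1ℤ ^ toℕ j * -1ℤ ^ toℕ (punchOut j≢l) * det (λ r → R r ∘ punchIn j ∘ punchIn (punchOut j≢l))

  pairCofactor-antisym : ∀ j l → pairCofactor j l ≡ - pairCofactor l j
  pairCofactor-antisym j l with j ≟ l | l ≟ j
  ... | yes _   | yes _   = refl
  ... | yes j≡l | no  l≢j = contradiction (sym j≡l) l≢j
  ... | no  j≢l | yes l≡j = contradiction (sym l≡j) j≢l
  ... | no  j≢l | no  l≢j = begin
    s j≢l * det (λ r → R r ∘ punchIn j ∘ punchIn (punchOut j≢l))     ≡⟨ cong₂ _*_ (-1^-punchOut-antisym j≢l l≢j)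
                                                                       (det-cong (λ r x → cong (R r) (punchIn-punchOut-comm j≢l l≢j x))) ⟩
    - s l≢j * det (λ r → R r ∘ punchIn l ∘ punchIn (punchOut l≢j))   ≡⟨ ℤ.neg-distribˡ-* (s l≢j) _ ⟨
    - (s l≢j * det (λ r → R r ∘ punchIn l ∘ punchIn (punchOut l≢j))) ∎
    where
    s : ∀ {i k : Fin (suc (suc n))} → i ≢ k → ℤ
    s {i} i≢k = -1ℤ ^ toℕ i * -1ℤ ^ toℕ (punchOut i≢k)

  pairCofactor-diag : ∀ j → pairCofactor j j ≡ 0ℤ
  pairCofactor-diag j with j ≟ j
  ... | yes _   = refl
  ... | no  j≢j = contradiction refl j≢j

  pairCofactor-punchIn : ∀ j c → pairCofactor j (punchIn j c) ≡
                         -1ℤ ^ toℕ j * -1ℤ ^ toℕ c * det (λ r → R r ∘ punchIn j ∘ punchIn c)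
  pairCofactor-punchIn j c with j ≟ punchIn j c
  ... | yes j≡l = contradiction (sym j≡l) (punchInᵢ≢i j c)
  ... | no  j≢l = cong (λ c′ → -1ℤ ^ toℕ j * -1ℤ ^ toℕ c′ * det (λ r → R r ∘ punchIn j ∘ punchIn c′))
                       (trans (punchOut-cong j refl) (punchOut-punchIn j))

  pairCofactor-mulᵥ : ∀ b j → (pairCofactor ·ᵥ b) j ≡ -1ℤ ^ toℕ j * det (b ∘ punchIn j ∷ λ r → R r ∘ punchIn j)
  pairCofactor-mulᵥ b j = begin
    sumℤ (λ l → pairCofactor j l * b l)                                    ≡⟨ sumℤ-remove j (λ l → pairCofactor j l * b l) ⟩
    pairCofactor j j * b j + sumℤ (λ c → pairCofactor j (punchIn j c) * b (punchIn j c))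
      ≡⟨ cong₂ _+_ (cong (_* b j) (pairCofactor-diag j)) (sumℤ-cong (λ c → cong (_* b (punchIn j c)) (pairCofactor-punchIn j c))) ⟩
    0ℤ + sumℤ (λ c → -1ℤ ^ toℕ j * -1ℤ ^ toℕ c * Δ c * b (punchIn j c))   ≡⟨ ℤ.+-identityˡ _ ⟩
    sumℤ (λ c → -1ℤ ^ toℕ j * -1ℤ ^ toℕ c * Δ c * b (punchIn j c))
      ≡⟨ sumℤ-cong (λ c → regroup (-1ℤ ^ toℕ j) (-1ℤ ^ toℕ c) (Δ c) (b (punchIn j c))) ⟩
    sumℤ (λ c → -1ℤ ^ toℕ j * (-1ℤ ^ toℕ c * (b (punchIn j c) * Δ c)))   ≡⟨ sumℤ-*ˡ (-1ℤ ^ toℕ j) (λ c → -1ℤ ^ toℕ c * (b (punchIn j c) * Δ c)) ⟩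
    -1ℤ ^ toℕ j * sumℤ (λ c → -1ℤ ^ toℕ c * (b (punchIn j c) * Δ c))     ≡⟨ cong (-1ℤ ^ toℕ j *_) (det-expand (b ∘ punchIn j ∷ λ r → R r ∘ punchIn j)) ⟨
    -1ℤ ^ toℕ j * det (b ∘ punchIn j ∷ λ r → R r ∘ punchIn j)            ∎
    where
    Δ : Fin (suc n) → ℤ
    Δ c = det (λ r → R r ∘ punchIn j ∘ punchIn c)
    regroup : ∀ s t d x → s * t * d * x ≡ s * (t * (x * d))
    regroup = solve-∀

  det-bilinear : ∀ a b → det (a ∷ b ∷ R) ≡ dot a (pairCofactor ·ᵥ b)
  det-bilinear a b = begin
    det (a ∷ b ∷ R)                                                       ≡⟨ det-expand (a ∷ b ∷ R) ⟩
    sumℤ (λ j → -1ℤ ^ toℕ j * (a j * det (b ∘ punchIn j ∷ λ r → R r ∘ punchIn j)))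
      ≡⟨ sumℤ-cong (λ j → trans (swap-sign (-1ℤ ^ toℕ j) (a j) _) (cong (a j *_) (sym (pairCofactor-mulᵥ b j)))) ⟩
    dot a (pairCofactor ·ᵥ b)                                             ∎
    where
    swap-sign : ∀ s x d → s * (x * d) ≡ x * (s * d)
    swap-sign = solve-∀

det-swap : ∀ {n} (a b : Fin (suc (suc n)) → ℤ) (R : Fin n → Fin (suc (suc n)) → ℤ) →
           det (a ∷ b ∷ R) ≡ - det (b ∷ a ∷ R)
det-swap a b R = begin
  det (a ∷ b ∷ R)               ≡⟨ det-bilinear R a b ⟩
  dot a (pairCofactor R ·ᵥ b)   ≡⟨ dot-mulᵥ-antisym (pairCofactor R) (pairCofactor-antisym R) a b ⟩
  - dot b (pairCofactor R ·ᵥ a) ≡⟨ cong -_ (det-bilinear R b a) ⟨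
  - det (b ∷ a ∷ R)             ∎

pivot : ∀ {n} → Fin (suc n) → Fin (suc n) → Fin (suc n)
pivot j = j ∷ punchIn j

det-pivot : ∀ {n} (M : Matrix (suc n)) j → det (M ∘ pivot j) ≡ -1ℤ ^ toℕ j * det M
det-pivot M zero = sym (ℤ.*-identityˡ (det M))
det-pivot {suc n} M (suc j) = begin
  det (M ∘ pivot (suc j))                          ≡⟨⟩
  det (M (suc j) ∷ M zero ∷ tail M ∘ punchIn j)    ≡⟨ det-swap (M (suc j)) (M zero) (tail M ∘ punchIn j) ⟩
  - det (M zero ∷ M (suc j) ∷ tail M ∘ punchIn j)  ≡⟨⟩
  - det (M zero ∷ tail M ∘ pivot j)                ≡⟨ cong -_ (det-∘-tail (pivot j) (-1ℤ ^ toℕ j) (λ N → det-pivot N j) (M zero) (tail M)) ⟩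
  - (-1ℤ ^ toℕ j * det M)                          ≡⟨ neg-*-assoc (-1ℤ ^ toℕ j) (det M) ⟩
  -1ℤ ^ toℕ (suc j) * det M                        ∎
  where
  neg-*-assoc : ∀ s d → - (s * d) ≡ (-1ℤ * s) * d
  neg-*-assoc = solve-∀

i≡-i⇒i≡0 : ∀ {i} → i ≡ - i → i ≡ 0ℤ
i≡-i⇒i≡0 {+0}       _ = refl
i≡-i⇒i≡0 {+[1+ _ ]} ()
i≡-i⇒i≡0 { -[1+ _ ]} ()

-1^k*-1^k*i≡i : ∀ k i → -1ℤ ^ k * (-1ℤ ^ k * i) ≡ i
-1^k*-1^k*i≡i zero    i = trans (ℤ.*-identityˡ (1ℤ * i)) (ℤ.*-identityˡ i)
-1^k*-1^k*i≡i (suc k) i = trans (cancel-neg (-1ℤ ^ k) i) (-1^k*-1^k*i≡i k i)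
  where
  cancel-neg : ∀ s i → -1ℤ * s * (-1ℤ * s * i) ≡ s * (s * i)
  cancel-neg = solve-∀

det-repeatedRow : ∀ {n} (R : Fin n → Fin (suc n) → ℤ) x → det (R x ∷ R) ≡ 0ℤ
det-repeatedRow {suc n} R x = begin
  det (R x ∷ R)                         ≡⟨ -1^k*-1^k*i≡i (toℕ x) (det (R x ∷ R)) ⟨
  s * (s * det (R x ∷ R))               ≡⟨ cong (s *_) (det-∘-tail (pivot x) s (λ N → det-pivot N x) (R x) R) ⟨
  s * det (R x ∷ R ∘ pivot x)           ≡⟨⟩
  s * det (R x ∷ R x ∷ R ∘ punchIn x)   ≡⟨ cong (s *_) (i≡-i⇒i≡0 (det-swap (R x) (R x) (R ∘ punchIn x))) ⟩
  s * 0ℤ                                ≡⟨ ℤ.*-zeroʳ s ⟩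
  0ℤ                                    ∎
  where
  s : ℤ
  s = -1ℤ ^ toℕ x

-- adjugate M l j is the (j , l) cofactor: the minor of M ∘ pivot j at l deletes row j and column l.
adjugate : ∀ {n} → Matrix n → Matrix n
adjugate {zero}  M ()
adjugate {suc n} M l j = -1ℤ ^ toℕ j * (-1ℤ ^ toℕ l * det (minor (M ∘ pivot j) l))

adjugateᵀ-mulᵥ : ∀ {n} (M : Matrix (suc n)) a j →
                 (transpose (adjugate M) ·ᵥ a) j ≡ -1ℤ ^ toℕ j * det (a ∷ removeAt M j)
adjugateᵀ-mulᵥ {n} M a j = begin
  sumℤ (λ l → adjugate M l j * a l)                                     ≡⟨ sumℤ-cong (λ l → regroup (-1ℤ ^ toℕ j) (-1ℤ ^ toℕ l) (Δ l) (a l)) ⟩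
  sumℤ (λ l → -1ℤ ^ toℕ j * (-1ℤ ^ toℕ l * (a l * Δ l)))                ≡⟨ sumℤ-*ˡ (-1ℤ ^ toℕ j) (λ l → -1ℤ ^ toℕ l * (a l * Δ l)) ⟩
  -1ℤ ^ toℕ j * sumℤ (λ l → -1ℤ ^ toℕ l * (a l * Δ l))                  ≡⟨ cong (-1ℤ ^ toℕ j *_) (det-expand (a ∷ removeAt M j)) ⟨
  -1ℤ ^ toℕ j * det (a ∷ removeAt M j)                                  ∎
  where
  Δ : Fin (suc n) → ℤ
  Δ l = det (minor (M ∘ pivot j) l)
  regroup : ∀ s t d x → s * (t * d) * x ≡ s * (t * (x * d))
  regroup = solve-∀

adjugateᵀ-mulᵥ-diag : ∀ {n} (M : Matrix (suc n)) j → (transpose (adjugate M) ·ᵥ M j) j ≡ det M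
adjugateᵀ-mulᵥ-diag M j = begin
  (transpose (adjugate M) ·ᵥ M j) j      ≡⟨ adjugateᵀ-mulᵥ M (M j) j ⟩
  -1ℤ ^ toℕ j * det (M ∘ pivot j)        ≡⟨ cong (-1ℤ ^ toℕ j *_) (det-pivot M j) ⟩
  -1ℤ ^ toℕ j * (-1ℤ ^ toℕ j * det M)    ≡⟨ -1^k*-1^k*i≡i (toℕ j) (det M) ⟩
  det M                                  ∎

adjugateᵀ-mulᵥ-offDiag : ∀ {n} (M : Matrix (suc n)) {i j} → j ≢ i → (transpose (adjugate M) ·ᵥ M i) j ≡ 0ℤ
adjugateᵀ-mulᵥ-offDiag M {i} {j} j≢i = begin
  (transpose (adjugate M) ·ᵥ M i) j                                ≡⟨ adjugateᵀ-mulᵥ M (M i) j ⟩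
  -1ℤ ^ toℕ j * det (M i ∷ removeAt M j)                           ≡⟨ cong (λ r → -1ℤ ^ toℕ j * det (M r ∷ removeAt M j))
                                                                       (punchIn-punchOut j≢i) ⟨
  -1ℤ ^ toℕ j * det (removeAt M j (punchOut j≢i) ∷ removeAt M j)   ≡⟨ cong (-1ℤ ^ toℕ j *_) (det-repeatedRow (removeAt M j) (punchOut j≢i)) ⟩
  -1ℤ ^ toℕ j * 0ℤ                                                 ≡⟨ ℤ.*-zeroʳ (-1ℤ ^ toℕ j) ⟩
  0ℤ                                                               ∎

adjugate-mulᵥ : ∀ {n} (M : Matrix n) d → M ·ᵥ (adjugate M ·ᵥ d) ≗ λ i → det M * d i
adjugate-mulᵥ {zero}  M d ()
adjugate-mulᵥ {suc n} M d i = begin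
  (M ·ᵥ (adjugate M ·ᵥ d)) i                ≡⟨ dot-mulᵥ-transpose (adjugate M) (M i) d ⟩
  dot (transpose (adjugate M) ·ᵥ M i) d     ≡⟨ sumℤ-delta i (λ j j≢i → trans (cong (_* d j) (adjugateᵀ-mulᵥ-offDiag M j≢i)) (ℤ.*-zeroˡ (d j))) ⟩
  (transpose (adjugate M) ·ᵥ M i) i * d i   ≡⟨ cong (_* d i) (adjugateᵀ-mulᵥ-diag M i) ⟩
  det M * d i                               ∎

≗-from-reduce-last : ∀ {k} {u v : Fin (suc k) → ℤ} → reduce u ≗ reduce v → u (fromℕ k) ≡ v (fromℕ k) → u ≗ v
≗-from-reduce-last {zero}  _       u≡v zero    = u≡v
≗-from-reduce-last {suc k} reduce≗ _   zero    = reduce≗ zero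
≗-from-reduce-last {suc k} reduce≗ u≡v (suc p) = ≗-from-reduce-last (reduce≗ ∘ suc) u≡v p

≗-from-reduce-sum : ∀ {k} {u v : Fin (suc k) → ℤ} → reduce u ≗ reduce v → sumℤ u ≡ sumℤ v → u ≗ v
≗-from-reduce-sum {k} {u} {v} reduce≗ Σu≡Σv = ≗-from-reduce-last reduce≗ (∙-cancelˡ (sumℤ (reduce v)) _ _ (begin
  sumℤ (reduce v) + u (fromℕ k) ≡⟨ cong (_+ u (fromℕ k)) (sumℤ-cong reduce≗) ⟨
  sumℤ (reduce u) + u (fromℕ k) ≡⟨ sumℤ-init-last u ⟨
  sumℤ u                        ≡⟨ Σu≡Σv ⟩
  sumℤ v                        ≡⟨ sumℤ-init-last v ⟩
  sumℤ (reduce v) + v (fromℕ k) ∎))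

mulᵥ-reduce : ∀ {k} (M : Matrix (suc k)) (v : Fin (suc k) → ℤ) → v (fromℕ k) ≡ 0ℤ →
              ∀ i → ((λ r c → M (inject₁ r) (inject₁ c)) ·ᵥ reduce v) i ≡ (M ·ᵥ v) (inject₁ i)
mulᵥ-reduce {k} M v v-last≡0 i = begin
  front                                  ≡⟨ ℤ.+-identityʳ front ⟨
  front + 0ℤ                             ≡⟨ cong (front +_) last-term≡0 ⟨
  front + M p (fromℕ k) * v (fromℕ k)    ≡⟨ sumℤ-init-last (λ l → M p l * v l) ⟨
  (M ·ᵥ v) p                             ∎
  where
  p : Fin (suc k)
  p = inject₁ i
  front : ℤ
  front = sumℤ (λ c → M p (inject₁ c) * v (inject₁ c))
  last-term≡0 : M p (fromℕ k) * v (fromℕ k) ≡ 0ℤ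
  last-term≡0 = trans (cong (M p (fromℕ k) *_) v-last≡0) (ℤ.*-zeroʳ (M p (fromℕ k)))

module _ {n : ℕ} (G : Multigraph n) where

  private
    L A : Matrix n
    L = laplacian G
    A i j = Int.+ adj G i j

  laplacian-sym : ∀ i j → L i j ≡ L j i
  laplacian-sym i j with i ≟ j | j ≟ i
  ... | yes refl | yes _   = refl
  ... | yes i≡j  | no j≢i  = contradiction (sym i≡j) j≢i
  ... | no  i≢j  | yes j≡i = contradiction (sym j≡i) i≢j
  ... | no  _    | no  _   = cong (λ a → - (Int.+ a)) (symmetric G i j)

  laplacian-rowSum : ∀ i → sumℤ (L i) ≡ 0ℤ
  laplacian-rowSum i = begin
    sumℤ (L i)                                        ≡⟨ sumℤ-cong (λ j → add-sub (L i j) (A i j)) ⟩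
    sumℤ (λ j → (L i j + A i j) + - A i j)            ≡⟨ sumℤ-distrib-+ (λ j → L i j + A i j) (λ j → - A i j) ⟩
    sumℤ (λ j → L i j + A i j) + sumℤ (λ j → - A i j) ≡⟨ cong₂ _+_ (trans (sumℤ-delta i off-diag) diag) (sumℤ-neg (A i)) ⟩
    valency G i + - valency G i                       ≡⟨ ℤ.+-inverseʳ (valency G i) ⟩
    0ℤ                                                ∎
    where
    add-sub : ∀ x a → x ≡ (x + a) + - a
    add-sub = solve-∀
    off-diag : ∀ j → j ≢ i → L i j + A i j ≡ 0ℤ
    off-diag j j≢i with i ≟ j
    ... | yes i≡j = contradiction (sym i≡j) j≢i
    ... | no  _   = ℤ.+-inverseˡ (A i j)
    diag : L i i + A i i ≡ valency G i
    diag with i ≟ i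
    ... | yes _   = sub-add (valency G i) (A i i)
      where
      sub-add : ∀ v a → v - a + a ≡ v
      sub-add = solve-∀
    ... | no  i≢i = contradiction refl i≢i

  dot-laplacian : ∀ w σ → dot w (L ·ᵥ σ) ≡ dot (L ·ᵥ w) σ
  dot-laplacian w σ = trans (dot-mulᵥ-transpose L w σ)
    (sumℤ-cong (λ l → cong (_* σ l) (sumℤ-cong (λ j → cong (_* w j) (laplacian-sym j l)))))

  sum-laplacian-mulᵥ : ∀ w → sumℤ (L ·ᵥ w) ≡ 0ℤ
  sum-laplacian-mulᵥ w = begin
    sumℤ (L ·ᵥ w)                ≡⟨ sumℤ-cong (λ p → ℤ.*-identityˡ ((L ·ᵥ w) p)) ⟨
    dot (λ _ → 1ℤ) (L ·ᵥ w)      ≡⟨ dot-laplacian (λ _ → 1ℤ) w ⟩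
    dot (L ·ᵥ (λ _ → 1ℤ)) w      ≡⟨ sumℤ-zero (λ l → trans (cong (_* w l) (L·1≡0 l)) (ℤ.*-zeroˡ (w l))) ⟩
    0ℤ                           ∎
    where
    L·1≡0 : ∀ l → (L ·ᵥ (λ _ → 1ℤ)) l ≡ 0ℤ
    L·1≡0 l = trans (sumℤ-cong (λ j → ℤ.*-identityʳ (L l j))) (laplacian-rowSum l)

  laplacian-mulᵥ-shift : ∀ w c → L ·ᵥ (λ l → w l - c) ≗ L ·ᵥ w
  laplacian-mulᵥ-shift w c i = begin
    sumℤ (λ l → L i l * (w l - c))                    ≡⟨ sumℤ-cong (λ l → expand (L i l) (w l) c) ⟩
    sumℤ (λ l → L i l * w l + - c * L i l)            ≡⟨ sumℤ-distrib-+ (λ l → L i l * w l) (λ l → - c * L i l) ⟩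
    (L ·ᵥ w) i + sumℤ (λ l → - c * L i l)             ≡⟨ cong ((L ·ᵥ w) i +_) (sumℤ-*ˡ (- c) (L i)) ⟩
    (L ·ᵥ w) i + - c * sumℤ (L i)                     ≡⟨ cong (λ s → (L ·ᵥ w) i + - c * s) (laplacian-rowSum i) ⟩
    (L ·ᵥ w) i + - c * 0ℤ                             ≡⟨ cong ((L ·ᵥ w) i +_) (ℤ.*-zeroʳ (- c)) ⟩
    (L ·ᵥ w) i + 0ℤ                                   ≡⟨ ℤ.+-identityʳ ((L ·ᵥ w) i) ⟩
    (L ·ᵥ w) i                                        ∎
    where
    expand : ∀ x y c → x * (y - c) ≡ x * y + - c * x
    expand = solve-∀

basis : ∀ {n} → Fin n → Fin n → ℤ
basis p q with p ≟ q
... | yes _ = 1ℤ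
... | no  _ = 0ℤ

dot-basis : ∀ {n} (v : Fin n → ℤ) p → dot v (basis p) ≡ v p
dot-basis v p = trans (sumℤ-delta p off-diag) diag
  where
  off-diag : ∀ q → q ≢ p → v q * basis p q ≡ 0ℤ
  off-diag q q≢p with p ≟ q
  ... | yes p≡q = contradiction (sym p≡q) q≢p
  ... | no  _   = ℤ.*-zeroʳ (v q)
  diag : v p * basis p p ≡ v p
  diag with p ≟ p
  ... | yes _   = ℤ.*-identityʳ (v p)
  ... | no  p≢p = contradiction refl p≢p

punchIn-fromℕ : ∀ {k} (i : Fin k) → punchIn (fromℕ k) i ≡ inject₁ i
punchIn-fromℕ zero    = refl
punchIn-fromℕ (suc i) = cong suc (punchIn-fromℕ i)

reduce-insertAt-last : ∀ {k} (d : Fin k → ℤ) x → reduce (insertAt d (fromℕ k) x) ≗ d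
reduce-insertAt-last {k} d x i =
  trans (cong (insertAt d (fromℕ k) x) (sym (punchIn-fromℕ i))) (insertAt-punchIn d (fromℕ k) x i)

balance : ∀ {k} → (Fin k → ℤ) → Fin (suc k) → ℤ
balance {k} d = insertAt d (fromℕ k) (- sumℤ d)

balance-isDiv0 : ∀ {k} (d : Fin k → ℤ) → IsDiv0 (balance d)
balance-isDiv0 {k} d = begin
  sumℤ (balance d)                                ≡⟨ sumℤ-init-last (balance d) ⟩
  sumℤ (reduce (balance d)) + balance d (fromℕ k) ≡⟨ cong₂ _+_ (sumℤ-cong (reduce-insertAt-last d (- sumℤ d)))
                                                                (insertAt-lookup d (fromℕ k) (- sumℤ d)) ⟩
  sumℤ d + - sumℤ d                               ≡⟨ ℤ.+-inverseʳ (sumℤ d) ⟩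
  0ℤ                                              ∎

module _ {k : ℕ} (G : Multigraph (suc k)) where

  private
    L : Matrix (suc k)
    L = laplacian G
    L̃ : Matrix k
    L̃ = reducedLaplacian G
    m : ℤ
    m = jacOrder G
    last : Fin (suc k)
    last = fromℕ k

  reducedLaplacian-mulᵥ : ∀ w w̃ → (∀ i → w̃ i ≡ w (inject₁ i) - w last) → L̃ ·ᵥ w̃ ≗ reduce (L ·ᵥ w)
  reducedLaplacian-mulᵥ w w̃ w̃≡ i = begin
    (L̃ ·ᵥ w̃) i                       ≡⟨ sumℤ-cong (λ c → cong (L̃ i c *_) (w̃≡ c)) ⟩
    (L̃ ·ᵥ reduce shifted) i          ≡⟨ mulᵥ-reduce L shifted (ℤ.+-inverseʳ (w last)) i ⟩
    (L ·ᵥ shifted) (inject₁ i)       ≡⟨ laplacian-mulᵥ-shift G w (w last) (inject₁ i) ⟩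
    (L ·ᵥ w) (inject₁ i)             ∎
    where
    shifted : Fin (suc k) → ℤ
    shifted l = w l - w last

  monodromyWeight-divides : ∀ w → IsMonodromyWeight G w → ∀ p → m SD.∣ (L ·ᵥ w) p
  monodromyWeight-divides w isWeight p =
    SD.∣ᵤ⇒∣ (subst (m ∣_) (trans (dot-laplacian G w (basis p)) (dot-basis (L ·ᵥ w) p)) (isWeight (basis p)))

  reducedWeight-divisor : ∀ w̃ → IsReducedMonodromyWeight G w̃ →
                           Σ (Fin (suc k) → ℤ) λ D → IsDiv0 D × (∀ i → (L̃ ·ᵥ w̃) i ≡ m * reduce D i)
  reducedWeight-divisor w̃ (w , isWeight , w̃≡) = balance q , balance-isDiv0 q , equation
    where
    divides : ∀ i → m SD.∣ (L ·ᵥ w) (inject₁ i)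
    divides i = monodromyWeight-divides w isWeight (inject₁ i)
    q : Fin k → ℤ
    q i = SD.quotient (divides i)
    equation : ∀ i → (L̃ ·ᵥ w̃) i ≡ m * reduce (balance q) i
    equation i = begin
      (L̃ ·ᵥ w̃) i                ≡⟨ reducedLaplacian-mulᵥ w w̃ w̃≡ i ⟩
      (L ·ᵥ w) (inject₁ i)      ≡⟨ SD._∣_.equality (divides i) ⟩
      q i * m                   ≡⟨ ℤ.*-comm (q i) m ⟩
      m * q i                   ≡⟨ cong (m *_) (reduce-insertAt-last q (- sumℤ q) i) ⟨
      m * reduce (balance q) i  ∎

  solution-isReducedWeight : ∀ w̃ D → IsDiv0 D → (∀ i → (L̃ ·ᵥ w̃) i ≡ m * reduce D i) → IsReducedMonodromyWeight G w̃
  solution-isReducedWeight w̃ D D-div0 equation = w , isWeight , w̃≡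
    where
    w : Fin (suc k) → ℤ
    w = insertAt w̃ last 0ℤ
    w̃≡ : ∀ i → w̃ i ≡ w (inject₁ i) - w last
    w̃≡ i = sym (trans (cong₂ _-_ (reduce-insertAt-last w̃ 0ℤ i) (insertAt-lookup w̃ last 0ℤ)) (ℤ.+-identityʳ (w̃ i)))
    Lw≗mD : L ·ᵥ w ≗ λ p → m * D p
    Lw≗mD = ≗-from-reduce-sum (λ i → trans (sym (reducedLaplacian-mulᵥ w w̃ w̃≡ i)) (equation i)) (begin
      sumℤ (L ·ᵥ w)                ≡⟨ sum-laplacian-mulᵥ G w ⟩
      0ℤ                           ≡⟨ ℤ.*-zeroʳ m ⟨
      m * 0ℤ                       ≡⟨ cong (m *_) D-div0 ⟨
      m * sumℤ D                   ≡⟨ sumℤ-*ˡ m D ⟨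
      sumℤ (λ p → m * D p)         ∎)
    isWeight : IsMonodromyWeight G w
    isWeight σ = SD.∣⇒∣ᵤ (SD.divides (dot D σ) (begin
      dot w (L ·ᵥ σ)               ≡⟨ dot-laplacian G w σ ⟩
      dot (L ·ᵥ w) σ               ≡⟨ sumℤ-cong (λ p → cong (_* σ p) (Lw≗mD p)) ⟩
      sumℤ (λ p → m * D p * σ p)   ≡⟨ sumℤ-cong (λ p → ℤ.*-assoc m (D p) (σ p)) ⟩
      sumℤ (λ p → m * (D p * σ p)) ≡⟨ sumℤ-*ˡ m (λ p → D p * σ p) ⟩
      m * dot D σ                  ≡⟨ ℤ.*-comm m (dot D σ) ⟩
      dot D σ * m                  ∎))

  divisor-reducedWeight : ∀ D → IsDiv0 D →
                          Σ (Fin k → ℤ) λ w̃ → (∀ i → (L̃ ·ᵥ w̃) i ≡ m * reduce D i) × IsReducedMonodromyWeight G w̃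
  divisor-reducedWeight D D-div0 = w̃ , equation , solution-isReducedWeight w̃ D D-div0 equation
    where
    w̃ : Fin k → ℤ
    w̃ = adjugate L̃ ·ᵥ reduce D
    equation : ∀ i → (L̃ ·ᵥ w̃) i ≡ m * reduce D i
    equation = adjugate-mulᵥ L̃ (reduce D)

proposition2p3 : (k : ℕ) → (G : Multigraph (suc k)) → Connected G →
    ((w̃ : Fin k → ℤ) → IsReducedMonodromyWeight G w̃ →
      Σ (Fin (suc k) → ℤ) λ D → IsDiv0 D ×
        (∀ i → (reducedLaplacian G ·ᵥ w̃) i ≡ jacOrder G * reduce D i))
    ×
    ((D : Fin (suc k) → ℤ) → IsDiv0 D →
      Σ (Fin k → ℤ) λ w̃ →
        (∀ i → (reducedLaplacian G ·ᵥ w̃) i ≡ jacOrder G * reduce D i) ×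
        IsReducedMonodromyWeight G w̃)
proposition2p3 k G _ = reducedWeight-divisor G , divisor-reducedWeight G
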